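{- Let $G$ be a connected graph. Then $tmc(G)=3$ if and only if $G$ is a path.
   Context: All graphs are simple, finite and undirected. A graph is total-colored if all its edges and all its vertices are assigned colors. A path in a total-colored graph is a total monochromatic path if all its edges and all its internal vertices have the same color. A total-coloring of a graph is a TMC-coloring (total monochromatically-connecting coloring) if any two vertices of the graph are connected by a total monochromatic path. For a connected graph $G$, the total monochromatic connection number $tmc(G)$ is the maximum number of colors used in a TMC-coloring of $G$. -}

module Defs where

open import Data.Nat using (ℕ; zero; suc; _≤_)
open import Data.Fin using (Fin; toℕ)
open import Data.Bool using (Bool; true; false)
open import Data.List using (List; []; _∷_)
open import Data.List.Relation.Unary.Unique.Propositional using (Unique)
open import Data.Product using (Σ; ∃; ∃-syntax; _×_; _,_)
open import Data.Sum using (_⊎_)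
open import Function.Bundles using (Inverse; _⇔_; _↔_)
open import Relation.Binary.PropositionalEquality using (_≡_; _≢_)

record Graph (n : ℕ) : Set where
  field
    Adj    : Fin n → Fin n → Bool
    sym    : ∀ u v → Adj u v ≡ Adj v u
    irrefl : ∀ v → Adj v v ≡ false

open Graph public

module _ {n : ℕ} (G : Graph n) where

  data Reach : Fin n → Fin n → Set where
    here : ∀ {v} → Reach v v
    step : ∀ {u w v} → Adj G u w ≡ true → Reach w v → Reach u v

  Connected : Set
  Connected = ∀ u v → Reach u v

  record TotalColoring (k : ℕ) : Set where
    field
      vcol    : Fin n → Fin k
      ecol    : Fin n → Fin n → Fin k
      ecolSym : ∀ u v → ecol u v ≡ ecol v u

  open TotalColoring public

  UsesAllColors : ∀ {k} → TotalColoring k → Set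
  UsesAllColors {k} χ = ∀ (c : Fin k) →
    (∃[ v ] vcol χ v ≡ c) ⊎ (∃[ u ] ∃[ v ] (Adj G u v ≡ true × ecol χ u v ≡ c))

  module _ {k : ℕ} (χ : TotalColoring k) (c : Fin k) where
    data MonoWalk : Fin n → Fin n → Set where
      edge : ∀ {u v} → Adj G u v ≡ true → ecol χ u v ≡ c → MonoWalk u v
      cons : ∀ {u w v} → Adj G u w ≡ true → ecol χ u w ≡ c → vcol χ w ≡ c →
             MonoWalk w v → MonoWalk u v

    verts : ∀ {u v} → MonoWalk u v → List (Fin n)
    verts {u} {v} (edge _ _)       = u ∷ v ∷ []
    verts {u}     (cons _ _ _ w)   = u ∷ verts w

  TotalMonoPath : ∀ {k} → TotalColoring k → Fin n → Fin n → Set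
  TotalMonoPath {k} χ u v =
    Σ (Fin k) λ c → Σ (MonoWalk χ c u v) λ w → Unique (verts χ c w)

  IsTMC : ∀ {k} → TotalColoring k → Set
  IsTMC χ = ∀ u v → u ≢ v → TotalMonoPath χ u v

  HasTMC : ℕ → Set
  HasTMC k = Σ (TotalColoring k) λ χ → UsesAllColors χ × IsTMC χ

  TmcIs : ℕ → Set
  TmcIs m = HasTMC m × (∀ k → HasTMC k → k ≤ m)

PathAdj : ∀ {n} → Fin n → Fin n → Set
PathAdj i j = (suc (toℕ i) ≡ toℕ j) ⊎ (suc (toℕ j) ≡ toℕ i)

IsPath : ∀ {n} → Graph n → Set
IsPath {n} G = Σ (Fin n ↔ Fin n) λ f →
  ∀ i j → (Adj G (Inverse.to f i) (Inverse.to f j) ≡ true) ⇔ PathAdj i j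

module Submission where

-- On a path P_n, color every edge and inner vertex 0 and the two ends 1 and 2; conversely, in any
-- TMC-coloring of a path the total monochromatic path between the ends contains every edge and every
-- inner vertex, so only the colors of the two ends can differ from its color. If G is not a path, take a
-- maximal path. If it passes through every vertex, G has an edge off the path, a chord, and the chord can
-- be given a fourth color. Otherwise grow the vertex set of the path one outside neighbour at a time; the vertex
-- added last is, like the two ends of the path, avoidable by walks between any two vertices, so these
-- three vertices can be given three colors of their own, on top of the color 0 of everything else.

open import Defs hiding (sym)
open Graph using () renaming (sym to Adj-sym)
open import Data.Bool using (Bool; true; if_then_else_)
import Data.Bool.Properties as Bool
open import Data.Empty using (⊥; ⊥-elim)
open import Data.Fin as Fin using (Fin; zero; suc; toℕ; fromℕ<)
open import Data.Fin.Properties as Finₚ using (toℕ<n; toℕ-fromℕ<; toℕ-injective; injective⇒≤)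
open import Data.Fin.Subset using (Subset; ∣_∣; ⁅_⁆; _∪_) renaming (_∈_ to _∈ₛ_; _∉_ to _∉ₛ_)
open import Data.Fin.Subset.Properties using (x∈⁅x⁆; x∈⁅y⁆⇒x≡y; x∈p∪q⁻; x∈p∪q⁺; p⊆p∪q; p⊂q⇒∣p∣<∣q∣; ∣p∣≤n; ∣p∣≡n⇒p≡⊤; ∈⊤)
  renaming (_∈?_ to _∈ₛ?_)
open import Data.List using (List; []; _∷_; length; lookup)
open import Data.List.Membership.Propositional using (_∈_; _∉_)
open import Data.List.Membership.Propositional.Properties using (∈-lookup)
open import Data.List.Relation.Binary.Subset.Propositional using (_⊆_)
open import Data.List.Relation.Unary.All as All using (All)
open import Data.List.Relation.Unary.All.Properties using (¬Any⇒All¬; All¬⇒¬Any)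
open import Data.List.Relation.Unary.AllPairs using ([]; _∷_)
open import Data.List.Relation.Unary.Any as Any using (here; there)
open import Data.List.Relation.Unary.Unique.Propositional using (Unique)
open import Data.Nat using (ℕ; zero; suc; _+_; _∸_; _≤_; _<_; _<?_; z≤n; s≤s)
open import Data.Nat.Properties
open import Data.Nat.DivMod using (_mod_; m<n⇒m%n≡m)
open import Data.Vec using (tabulate)
open import Data.Vec.Properties using (lookup∘tabulate; []=⇒lookup; lookup⇒[]=)
open import Data.Product using (Σ; ∃; ∃₂; _×_; _,_; proj₁; proj₂)
open import Data.Sum as Sum using (_⊎_; inj₁; inj₂)
open import Function using (_∘_)
open import Level using (0ℓ)
open import Relation.Binary using (Rel; DecidableEquality; tri<; tri≈; tri>)
open import Relation.Binary.Construct.Closure.ReflexiveTransitive as Star using (Star; ε; _◅_; _◅◅_)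
open import Relation.Binary.PropositionalEquality
open import Relation.Nullary using (¬_; ¬?; yes; no; Dec; does; _×-dec_; _⊎-dec_)
open import Relation.Nullary.Decidable as Dec using (dec-true; dec-false; does-⇔; decidable-stable)
open import Function.Bundles using (Equivalence; Inverse; _⇔_; mk⇔; mk↔ₛ′)

module _ {a ℓ} {A : Set a} {E : Rel A ℓ} where

  vertices : ∀ {u v} → Star E u v → List A
  vertices {u} ε       = u ∷ []
  vertices {u} (_ ◅ p) = u ∷ vertices p

  AllInner : ∀ {q} (Q : A → Set q) {u v} → Star E u v → Set (a Level.⊔ q)
  AllInner Q {u} {v} p = ∀ {x} → x ∈ vertices p → x ≡ u ⊎ x ≡ v ⊎ Q x

  end∈vertices : ∀ {u v} (p : Star E u v) → v ∈ vertices p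
  end∈vertices ε       = here refl
  end∈vertices (_ ◅ p) = there (end∈vertices p)

  ∈-vertices-◅◅ : ∀ {u w v x} (p : Star E u w) (q : Star E w v) →
                  x ∈ vertices (p ◅◅ q) → x ∈ vertices p ⊎ x ∈ vertices q
  ∈-vertices-◅◅ ε       q x∈       = inj₂ x∈
  ∈-vertices-◅◅ (_ ◅ p) q (here eq) = inj₁ (here eq)
  ∈-vertices-◅◅ (_ ◅ p) q (there x∈) = Sum.map₁ there (∈-vertices-◅◅ p q x∈)

  suffixFrom : ∀ {u w v} (p : Star E w v) → Unique (vertices p) → u ∈ vertices p →
               Σ (Star E u v) λ q → Unique (vertices q) × vertices q ⊆ vertices p
  suffixFrom ε       up       (here refl) = ε , up , λ x∈ → x∈
  suffixFrom (e ◅ p) up       (here refl) = e ◅ p , up , λ x∈ → x∈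
  suffixFrom (_ ◅ p) (_ ∷ up) (there u∈)  =
    let (q , uq , q⊆p) = suffixFrom p up u∈ in q , uq , λ x∈ → there (q⊆p x∈)

  shortcut : DecidableEquality A → ∀ {u v} (p : Star E u v) →
             Σ (Star E u v) λ q → Unique (vertices q) × vertices q ⊆ vertices p
  shortcut _≟_ ε = ε , All.[] ∷ [] , λ x∈ → x∈
  shortcut _≟_ {u} (e ◅ p) with shortcut _≟_ p
  ... | q , uq , q⊆p with Any.any? (u ≟_) (vertices q)
  ...   | yes u∈q = let (r , ur , r⊆q) = suffixFrom q uq u∈q in r , ur , λ x∈ → there (q⊆p (r⊆q x∈))
  ...   | no u∉q  = e ◅ q , ¬Any⇒All¬ _ u∉q ∷ uq , λ { (here eq) → here eq ; (there x∈) → there (q⊆p x∈) }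

inner : ∀ {a q} {A : Set a} {Q : A → Set q} {u v x : A} → x ≡ u ⊎ x ≡ v ⊎ Q x → x ≢ u → x ≢ v → Q x
inner (inj₁ x≡u)        x≢u _   = ⊥-elim (x≢u x≡u)
inner (inj₂ (inj₁ x≡v)) _   x≢v = ⊥-elim (x≢v x≡v)
inner (inj₂ (inj₂ qx))  _   _   = qx

vertices-map : ∀ {a ℓ₁ ℓ₂} {A : Set a} {E : Rel A ℓ₁} {F : Rel A ℓ₂} (f : ∀ {x y} → E x y → F x y) →
               ∀ {u v} (p : Star E u v) → vertices (Star.map f p) ≡ vertices p
vertices-map f ε           = refl
vertices-map f {u} (_ ◅ p) = cong (u ∷_) (vertices-map f p)

index-lookup : ∀ {a} {A : Set a} {xs : List A} → Unique xs → ∀ i (x∈ : lookup xs i ∈ xs) → Any.index x∈ ≡ i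
index-lookup _        zero    (here _)   = refl
index-lookup (x∉ ∷ _) zero    (there x∈) = ⊥-elim (All.lookup x∉ x∈ refl)
index-lookup (x∉ ∷ _) (suc i) (here eq)  = ⊥-elim (All.lookup x∉ (∈-lookup i) (sym eq))
index-lookup (_ ∷ xs-unique) (suc i) (there x∈) = cong suc (index-lookup xs-unique i x∈)

cover⇒≤ : ∀ {m k} (f : Fin m → Fin k) → (∀ d → ∃ λ t → f t ≡ d) → k ≤ m
cover⇒≤ f cover = injective⇒≤ {f = proj₁ ∘ cover}
  λ {d} {d′} e → trans (sym (proj₂ (cover d))) (trans (cong f e) (proj₂ (cover d′)))

∉⇒∣p∣<n : ∀ {n} {p : Subset n} {x} → x ∉ₛ p → ∣ p ∣ < n
∉⇒∣p∣<n {p = p} {x} x∉p = ≤∧≢⇒< (∣p∣≤n p) λ e → x∉p (subst (x ∈ₛ_) (sym (∣p∣≡n⇒p≡⊤ e)) ∈⊤)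

Consecutive : ℕ → ℕ → Set
Consecutive i j = suc i ≡ j ⊎ suc j ≡ i

consecutive? : ∀ i j → Dec (Consecutive i j)
consecutive? i j = (suc i ≟ j) ⊎-dec (suc j ≟ i)

consecutive-crossing : ∀ {p q m} → Consecutive p q → p ≤ m → m < q → p ≡ m × q ≡ suc m
consecutive-crossing (inj₁ refl) p≤m m<1+p = let p≡m = ≤-antisym p≤m (≤-pred m<1+p) in p≡m , cong suc p≡m
consecutive-crossing (inj₂ refl) q<m m<q   = ⊥-elim (<-asym q<m m<q)

consecutive-no-gap : ∀ {p q m} → Consecutive p q → p < m → m < q → ⊥
consecutive-no-gap (inj₁ refl) p<m m<1+p = <⇒≱ p<m (≤-pred m<1+p)
consecutive-no-gap (inj₂ refl) p<m m<q   = <-asym (<-trans (n<1+n _) p<m) m<q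

module _ {a ℓ} {A : Set a} (E : Rel A ℓ) (g : ℕ → A) {m : ℕ}
         (forward  : ∀ {i} → i < m → E (g i) (g (suc i)))
         (backward : ∀ {i} → i < m → E (g (suc i)) (g i)) where

  private
    Between : ℕ → ℕ → A → Set a
    Between i j x = ∃ λ k → i ≤ k × k ≤ j × g k ≡ x

    ascending : ∀ i d → i + d ≤ m →
                Σ (Star E (g i) (g (i + d))) λ p → ∀ {x} → x ∈ vertices p → Between i (i + d) x
    ascending i zero _ rewrite +-identityʳ i = ε , λ { (here refl) → i , ≤-refl , ≤-refl , refl }
    ascending i (suc d) bound rewrite +-suc i d =
      let (p , p⊆) = ascending (suc i) d bound
      in forward (<-≤-trans (s≤s (m≤m+n i d)) bound) ◅ p ,
         λ { (here refl) → i , ≤-refl , m≤n⇒m≤1+n (m≤m+n i d) , refl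
           ; (there x∈)  → let (k , i<k , k≤ , gk) = p⊆ x∈ in k , <⇒≤ i<k , k≤ , gk }

    descending : ∀ i d → i + d ≤ m →
                 Σ (Star E (g (i + d)) (g i)) λ p → ∀ {x} → x ∈ vertices p → Between i (i + d) x
    descending i zero _ rewrite +-identityʳ i = ε , λ { (here refl) → i , ≤-refl , ≤-refl , refl }
    descending i (suc d) bound rewrite +-suc i d =
      let (p , p⊆) = descending i d (<⇒≤ bound)
      in backward bound ◅ p ,
         λ { (here refl) → suc (i + d) , m≤n⇒m≤1+n (m≤m+n i d) , ≤-refl , refl
           ; (there x∈)  → let (k , i≤k , k≤ , gk) = p⊆ x∈ in k , i≤k , m≤n⇒m≤1+n k≤ , gk }

    InnerVertex : A → Set a
    InnerVertex x = ∃ λ k → 0 < k × k < m × g k ≡ x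

    between⇒inner : ∀ {i j x} → j ≤ m → Between i j x → x ≡ g i ⊎ x ≡ g j ⊎ InnerVertex x
    between⇒inner j≤m (k , i≤k , k≤j , refl) with m≤n⇒m<n∨m≡n i≤k | m≤n⇒m<n∨m≡n k≤j
    ... | inj₂ refl | _         = inj₁ refl
    ... | _         | inj₂ refl = inj₂ (inj₁ refl)
    ... | inj₁ i<k  | inj₁ k<j  = inj₂ (inj₂ (k , ≤-trans (s≤s z≤n) i<k , <-≤-trans k<j j≤m , refl))

    swap : ∀ {x y z} → x ≡ y ⊎ x ≡ z ⊎ InnerVertex x → x ≡ z ⊎ x ≡ y ⊎ InnerVertex x
    swap (inj₁ e)        = inj₂ (inj₁ e)
    swap (inj₂ (inj₁ e)) = inj₁ e
    swap (inj₂ (inj₂ q)) = inj₂ (inj₂ q)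

  segment : ∀ {i j} → i ≤ m → j ≤ m →
            Σ (Star E (g i) (g j)) (AllInner λ x → ∃ λ k → 0 < k × k < m × g k ≡ x)
  segment {i} {j} i≤m j≤m with ≤-total i j
  ... | inj₁ i≤j with m≤n⇒∃[o]m+o≡n i≤j
  ...   | d , refl = let (p , p⊆) = ascending i d j≤m in p , λ x∈ → between⇒inner j≤m (p⊆ x∈)
  segment {i} {j} i≤m j≤m | inj₂ j≤i with m≤n⇒∃[o]m+o≡n j≤i
  ...   | d , refl = let (p , p⊆) = descending j d i≤m in p , λ x∈ → swap (between⇒inner i≤m (p⊆ x∈))

module _ {n : ℕ} (G : Graph n) where

  open import Data.List.Membership.DecPropositional (Finₚ._≟_ {n}) using (_∈?_)

  Adjacent : Rel (Fin n) 0ℓ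
  Adjacent x y = Adj G x y ≡ true

  module _ {k : ℕ} (χ : TotalColoring G k) (c : Fin k) where

    ColoredEdge : Rel (Fin n) 0ℓ
    ColoredEdge x y = Adjacent x y × ecol χ x y ≡ c

    private
      toMonoWalk : ∀ {u v} (p : Star ColoredEdge u v) → Unique (vertices p) → u ≢ v →
                   (∀ {x} → x ∈ vertices p → x ≢ u → x ≢ v → vcol χ x ≡ c) →
                   Σ (MonoWalk G χ c u v) λ w → verts G χ c w ≡ vertices p
      toMonoWalk ε _ u≢v _ = ⊥-elim (u≢v refl)
      toMonoWalk ((u~v , e) ◅ ε) _ _ _ = edge u~v e , refl
      toMonoWalk {u} {v} (_◅_ {j = w} (u~w , e) p@(_ ◅ rest)) (u∉p ∷ w∉rest ∷ urest) _ p-inner =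
        let (mw , eq) = toMonoWalk p (w∉rest ∷ urest) w≢v λ x∈ x≢w → p-inner (there x∈) (u≢ x∈)
        in cons u~w e (p-inner (there (here refl)) (u≢ (here refl)) w≢v) mw , cong (u ∷_) eq
        where
          w≢v : w ≢ v
          w≢v = All.lookup w∉rest (end∈vertices rest)
          u≢ : ∀ {x} → x ∈ vertices p → x ≢ u
          u≢ x∈ x≡u = All.lookup u∉p x∈ (sym x≡u)

    coloredWalk⇒totalMonoPath : ∀ {u v} (p : Star ColoredEdge u v) → u ≢ v →
                                AllInner (λ x → vcol χ x ≡ c) p → TotalMonoPath G χ u v
    coloredWalk⇒totalMonoPath p u≢v p-inner =
      let (q , uq , q⊆p) = shortcut Finₚ._≟_ p
          (w , eq)       = toMonoWalk q uq u≢v λ x∈ → inner {Q = λ x → vcol χ x ≡ c} (p-inner (q⊆p x∈))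
      in c , w , subst Unique (sym eq) uq

  walk⇒edge : ∀ {u v} → Star Adjacent u v → u ≢ v → ∃₂ Adjacent
  walk⇒edge ε       u≢v = ⊥-elim (u≢v refl)
  walk⇒edge (e ◅ _) _   = _ , _ , e

  module _ (leaves : List (Fin n)) where

    leafColor : Fin n → Fin (suc (length leaves))
    leafColor x with x ∈? leaves
    ... | yes x∈ = suc (Any.index x∈)
    ... | no  _  = zero

    leafColor-lookup : Unique leaves → ∀ i → leafColor (lookup leaves i) ≡ suc i
    leafColor-lookup leaves-unique i with lookup leaves i ∈? leaves
    ... | yes x∈ = cong suc (index-lookup leaves-unique i x∈)
    ... | no x∉  = ⊥-elim (x∉ (∈-lookup i))

    leafColor-nonleaf : ∀ {x} → x ∉ leaves → leafColor x ≡ zero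
    leafColor-nonleaf {x} x∉ with x ∈? leaves
    ... | yes x∈ = ⊥-elim (x∉ x∈)
    ... | no  _  = refl

    leafColoring : TotalColoring G (suc (length leaves))
    leafColoring = record { vcol = leafColor ; ecol = λ _ _ → zero ; ecolSym = λ _ _ → refl }

    leaves⇒HasTMC : Unique leaves → (∀ {u v} → u ≢ v → Σ (Star Adjacent u v) (AllInner (_∉ leaves))) →
                    ∀ {a b} → a ≢ b → HasTMC G (suc (length leaves))
    leaves⇒HasTMC leaves-unique walk a≢b = leafColoring , uses , tmc
      where
        uses : UsesAllColors G leafColoring
        uses zero    = let (x , y , x~y) = walk⇒edge (proj₁ (walk a≢b)) a≢b in inj₂ (x , y , x~y , refl)
        uses (suc i) = inj₁ (lookup leaves i , leafColor-lookup leaves-unique i)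

        tmc : IsTMC G leafColoring
        tmc u v u≢v =
          let (p , p-inner) = walk u≢v
          in coloredWalk⇒totalMonoPath leafColoring zero (Star.map (λ e → e , refl) p) u≢v
               λ x∈ → Sum.map₂ (Sum.map₂ leafColor-nonleaf) (p-inner (subst (_ ∈_) (vertices-map _ p) x∈))

  record SimplePath : Set where
    field
      len              : ℕ
      vertex           : ℕ → Fin n
      vertex-injective : ∀ {i j} → i ≤ len → j ≤ len → vertex i ≡ vertex j → i ≡ j
      vertex-adjacent  : ∀ {i} → i < len → Adjacent (vertex i) (vertex (suc i))

    first last : Fin n
    first = vertex 0
    last  = vertex len

    OnPath : Fin n → Set
    OnPath x = ∃ λ i → i ≤ len × vertex i ≡ x

    onPath? : ∀ x → Dec (OnPath x)
    onPath? x = Dec.map′ (λ (i , e) → toℕ i , ≤-pred (toℕ<n i) , e)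
                         (λ (i , i≤ , e) → fromℕ< (s≤s i≤) , trans (cong vertex (toℕ-fromℕ< _)) e)
                         (Finₚ.any? λ (i : Fin (suc len)) → vertex (toℕ i) Finₚ.≟ x)

    Saturated : Fin n → Set
    Saturated v = ∀ {y} → Adjacent v y → OnPath y

    vertex-backward : ∀ {i} → i < len → Adjacent (vertex (suc i)) (vertex i)
    vertex-backward i<len = trans (Adj-sym G _ _) (vertex-adjacent i<len)

    walkAlong : ∀ {i j} → i ≤ len → j ≤ len →
                Σ (Star Adjacent (vertex i) (vertex j)) (AllInner λ x → ∃ λ k → 0 < k × k < len × vertex k ≡ x)
    walkAlong = segment Adjacent vertex vertex-adjacent vertex-backward

    first≢last : 0 < len → first ≢ last
    first≢last 0<len e = <-irrefl (vertex-injective z≤n ≤-refl e) 0<len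

    inner≢first : ∀ {k} → 0 < k → k ≤ len → vertex k ≢ first
    inner≢first 0<k k≤len e = <-irrefl (sym (vertex-injective k≤len z≤n e)) 0<k

    inner≢last : ∀ {k} → k < len → vertex k ≢ last
    inner≢last k<len e = <-irrefl (vertex-injective (<⇒≤ k<len) ≤-refl e) k<len

    1+len≤n : suc len ≤ n
    1+len≤n = injective⇒≤ {f = λ (i : Fin (suc len)) → vertex (toℕ i)}
                λ {i} {j} e → toℕ-injective (vertex-injective (≤-pred (toℕ<n i)) (≤-pred (toℕ<n j)) e)

  open SimplePath

  prepend : (P : SimplePath) {y : Fin n} → Adjacent (first P) y → ¬ OnPath P y → SimplePath
  prepend P {y} first~y y∉P = record
    { len              = suc (len P)
    ; vertex           = vertex′
    ; vertex-injective = injective′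
    ; vertex-adjacent  = adjacent′
    }
    where
      vertex′ : ℕ → Fin n
      vertex′ zero    = y
      vertex′ (suc i) = vertex P i

      injective′ : ∀ {i j} → i ≤ suc (len P) → j ≤ suc (len P) → vertex′ i ≡ vertex′ j → i ≡ j
      injective′ {zero}  {zero}  _         _         _ = refl
      injective′ {zero}  {suc j} _         (s≤s j≤)  e = ⊥-elim (y∉P (j , j≤ , sym e))
      injective′ {suc i} {zero}  (s≤s i≤)  _         e = ⊥-elim (y∉P (i , i≤ , e))
      injective′ {suc i} {suc j} (s≤s i≤)  (s≤s j≤)  e = cong suc (vertex-injective P i≤ j≤ e)

      adjacent′ : ∀ {i} → i < suc (len P) → Adjacent (vertex′ i) (vertex′ (suc i))
      adjacent′ {zero}  _          = trans (Adj-sym G y (first P)) first~y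
      adjacent′ {suc i} (s≤s i<len) = vertex-adjacent P i<len

  reverse : SimplePath → SimplePath
  reverse P = record
    { len              = len P
    ; vertex           = λ i → vertex P (len P ∸ i)
    ; vertex-injective = λ {i} {j} i≤ j≤ e → ∸-cancelˡ-≡ i≤ j≤ (vertex-injective P (m∸n≤m _ i) (m∸n≤m _ j) e)
    ; vertex-adjacent  = adjacent′
    }
    where
      adjacent′ : ∀ {i} → i < len P → Adjacent (vertex P (len P ∸ i)) (vertex P (len P ∸ suc i))
      adjacent′ {i} i<len = subst (λ k → Adjacent (vertex P k) (vertex P (len P ∸ suc i)))
                              (sym (+-∸-assoc 1 i<len)) (vertex-backward P (∸-monoʳ-< (s≤s z≤n) i<len))

  reverse-onPath : ∀ P {x} → OnPath P x → OnPath (reverse P) x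
  reverse-onPath P (i , i≤ , e) = len P ∸ i , m∸n≤m _ i , trans (cong (vertex P) (m∸[m∸n]≡n i≤)) e

  reverse-last : ∀ P → last (reverse P) ≡ first P
  reverse-last P = cong (vertex P) (n∸n≡0 (len P))

  saturateFirst : (P : SimplePath) → Σ SimplePath λ Q →
                  Saturated Q (first Q) × (∀ {x} → OnPath P x → OnPath Q x) × last Q ≡ last P
  saturateFirst P = go n P (m≤n+m n (len P))
    where
      go : ∀ fuel (P : SimplePath) → n ≤ len P + fuel → Σ SimplePath λ Q →
           Saturated Q (first Q) × (∀ {x} → OnPath P x → OnPath Q x) × last Q ≡ last P
      go zero P n≤len = ⊥-elim (n≮n (len P) (≤-trans (1+len≤n P) (subst (n ≤_) (+-identityʳ _) n≤len)))
      go (suc fuel) P n≤ with Finₚ.any? (λ y → (Adj G (first P) y Bool.≟ true) ×-dec ¬? (onPath? P y))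
      ... | yes (y , first~y , y∉P) =
        let (Q , saturated , P⊆Q , last≡) = go fuel (prepend P first~y y∉P) (subst (n ≤_) (+-suc _ fuel) n≤)
        in Q , saturated , (λ (i , i≤ , e) → P⊆Q (suc i , s≤s i≤ , e)) , last≡
      ... | no ∄y = P , saturated , (λ x∈ → x∈) , refl
        where
          saturated : Saturated P (first P)
          saturated {y} first~y with onPath? P y
          ... | yes y∈P = y∈P
          ... | no  y∉P = ⊥-elim (∄y (y , first~y , y∉P))

  trivialPath : Fin n → SimplePath
  trivialPath v = record
    { len = 0 ; vertex = λ _ → v ; vertex-injective = λ { z≤n z≤n _ → refl } ; vertex-adjacent = λ () }

  maximalPath : Fin n → Σ SimplePath λ P → Saturated P (first P) × Saturated P (last P)
  maximalPath v =
    let (P₁ , saturated₁ , _ , _)          = saturateFirst (trivialPath v)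
        (P₂ , saturated₂ , P₁⊆P₂ , last≡) = saturateFirst (reverse P₁)
    in P₂ , saturated₂ , λ last~y →
         P₁⊆P₂ (reverse-onPath P₁ (saturated₁ (subst (λ z → Adjacent z _) (trans last≡ (reverse-last P₁)) last~y)))

  Adjacent-irrefl : ∀ {x} → ¬ Adjacent x x
  Adjacent-irrefl {x} x~x with trans (sym x~x) (irrefl G x)
  ... | ()

  consecutive⇒adjacent : ∀ (P : SimplePath) {i j} → i ≤ len P → j ≤ len P →
                         Consecutive i j → Adjacent (vertex P i) (vertex P j)
  consecutive⇒adjacent P _   j≤len (inj₁ refl) = vertex-adjacent P j≤len
  consecutive⇒adjacent P i≤len _   (inj₂ refl) = vertex-backward P i≤len

  positiveLength : Connected G → (P : SimplePath) → Saturated P (first P) → ∀ {x} → x ≢ first P → 0 < len P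
  positiveLength conn P first-saturated {x} x≢first with conn (first P) x
  ... | here = ⊥-elim (x≢first refl)
  ... | step first~w _ with first-saturated first~w
  ...   | i , i≤len , refl = n≢0⇒n>0 λ len≡0 →
    Adjacent-irrefl (subst (λ k → Adjacent (first P) (vertex P k)) (n≤0⇒n≡0 (subst (i ≤_) len≡0 i≤len)) first~w)

  module _ (P : SimplePath) where

    Hamiltonian : Set
    Hamiltonian = ∀ x → OnPath P x

    Chord : Set
    Chord = ∃₂ λ i j → i ≤ len P × j ≤ len P × Adjacent (vertex P i) (vertex P j) × ¬ Consecutive i j

    Chordless : Set
    Chordless = ∀ {i j} → i ≤ len P → j ≤ len P → Adjacent (vertex P i) (vertex P j) → Consecutive i j

  module _ (P : SimplePath) (hamiltonian : Hamiltonian P) where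

    ends : List (Fin n)
    ends = first P ∷ last P ∷ []

    ends-unique : 0 < len P → Unique ends
    ends-unique 0<len = (first≢last P 0<len All.∷ All.[]) ∷ All.[] ∷ []

    inner∉ends : ∀ {k} → 0 < k → k < len P → vertex P k ∉ ends
    inner∉ends 0<k k<len = All¬⇒¬Any (inner≢first P 0<k (<⇒≤ k<len) All.∷ inner≢last P k<len All.∷ All.[])

    walkAvoidingEnds : ∀ u v → Σ (Star Adjacent u v) (AllInner (_∉ ends))
    walkAvoidingEnds u v with hamiltonian u | hamiltonian v
    ... | i , i≤len , refl | j , j≤len , refl =
      let (p , p-inner) = walkAlong P i≤len j≤len
      in p , λ x∈ → Sum.map₂ (Sum.map₂ λ { (k , 0<k , k<len , refl) → inner∉ends 0<k k<len }) (p-inner x∈)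

    hamiltonian⇒HasTMC3 : 0 < len P → HasTMC G 3
    hamiltonian⇒HasTMC3 0<len = leaves⇒HasTMC ends (ends-unique 0<len) (λ {u} {v} _ → walkAvoidingEnds u v) (first≢last P 0<len)

    pathColoring-isTMC : ∀ {k} (χ : TotalColoring G k) (c : Fin k) →
                         (∀ {i} → 0 < i → i < len P → vcol χ (vertex P i) ≡ c) →
                         (∀ {i} → i < len P → ecol χ (vertex P i) (vertex P (suc i)) ≡ c) → IsTMC G χ
    pathColoring-isTMC χ c inner-c edge-c u v u≢v with hamiltonian u | hamiltonian v
    ... | i , i≤len , refl | j , j≤len , refl =
      let (p , p-inner) = segment (ColoredEdge χ c) (vertex P)
                            (λ i<len → vertex-adjacent P i<len , edge-c i<len)
                            (λ i<len → vertex-backward P i<len , trans (ecolSym χ _ _) (edge-c i<len)) i≤len j≤len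
      in coloredWalk⇒totalMonoPath χ c p u≢v
           λ x∈ → Sum.map₂ (Sum.map₂ λ { (k , 0<k , k<len , refl) → inner-c 0<k k<len }) (p-inner x∈)

    -- Path edges and inner vertices get color 0, the two ends colors 1 and 2, the chord color 3.
    chord⇒HasTMC4 : 0 < len P → Chord P → HasTMC G 4
    chord⇒HasTMC4 0<len (a , b , a≤len , b≤len , a~b , a≁b) = χ , uses , tmc
      where
        ChordEnds : Fin n → Fin n → Set
        ChordEnds x y = (x ≡ vertex P a × y ≡ vertex P b) ⊎ (x ≡ vertex P b × y ≡ vertex P a)

        chordEnds? : ∀ x y → Dec (ChordEnds x y)
        chordEnds? x y = (x Finₚ.≟ vertex P a ×-dec y Finₚ.≟ vertex P b) ⊎-dec (x Finₚ.≟ vertex P b ×-dec y Finₚ.≟ vertex P a)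

        chordColor : Bool → Fin 4
        chordColor b = if b then Fin.fromℕ 3 else zero

        χ : TotalColoring G 4
        χ = record
          { vcol    = Fin.inject₁ ∘ leafColor ends
          ; ecol    = λ x y → chordColor (does (chordEnds? x y))
          ; ecolSym = λ x y → cong chordColor (does-⇔ (mk⇔ flipEnds flipEnds) (chordEnds? x y) (chordEnds? y x))
          }
          where
            flipEnds : ∀ {x y} → ChordEnds x y → ChordEnds y x
            flipEnds (inj₁ (x≡a , y≡b)) = inj₂ (y≡b , x≡a)
            flipEnds (inj₂ (x≡b , y≡a)) = inj₁ (y≡a , x≡b)

        path-edge : ∀ {i} → i < len P → ecol χ (vertex P i) (vertex P (suc i)) ≡ zero
        path-edge {i} i<len = cong chordColor (dec-false (chordEnds? _ _) not-chord)
          where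
            injective : ∀ {j k} → j ≤ len P → vertex P j ≡ vertex P k → k ≤ len P → j ≡ k
            injective j≤len e k≤len = vertex-injective P j≤len k≤len e
            not-chord : ¬ ChordEnds (vertex P i) (vertex P (suc i))
            not-chord (inj₁ (i≡a , 1+i≡b)) =
              a≁b (inj₁ (trans (cong suc (sym (injective (<⇒≤ i<len) i≡a a≤len))) (injective i<len 1+i≡b b≤len)))
            not-chord (inj₂ (i≡b , 1+i≡a)) =
              a≁b (inj₂ (trans (cong suc (sym (injective (<⇒≤ i<len) i≡b b≤len))) (injective i<len 1+i≡a a≤len)))

        tmc : IsTMC G χ
        tmc = pathColoring-isTMC χ zero (λ 0<i i<len → cong Fin.inject₁ (leafColor-nonleaf ends (inner∉ends 0<i i<len))) path-edge

        uses : UsesAllColors G χ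
        uses zero                   = inj₂ (vertex P 0 , vertex P 1 , vertex-adjacent P 0<len , path-edge 0<len)
        uses (suc zero)             = inj₁ (first P , cong Fin.inject₁ (leafColor-lookup ends (ends-unique 0<len) zero))
        uses (suc (suc zero))       = inj₁ (last P , cong Fin.inject₁ (leafColor-lookup ends (ends-unique 0<len) (suc zero)))
        uses (suc (suc (suc zero))) = inj₂ (vertex P a , vertex P b , a~b ,
                                            cong chordColor (dec-true (chordEnds? _ _) (inj₁ (refl , refl))))

    position : Fin n → ℕ
    position x = proj₁ (hamiltonian x)

    position≤len : ∀ x → position x ≤ len P
    position≤len x = proj₁ (proj₂ (hamiltonian x))

    vertex-position : ∀ x → vertex P (position x) ≡ x
    vertex-position x = proj₂ (proj₂ (hamiltonian x))

    position-vertex : ∀ {i} → i ≤ len P → position (vertex P i) ≡ i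
    position-vertex i≤len = vertex-injective P (position≤len _) i≤len (vertex-position _)

    position-injective : ∀ {x y} → position x ≡ position y → x ≡ y
    position-injective {x} {y} e = trans (sym (vertex-position x)) (trans (cong (vertex P) e) (vertex-position y))

    n≡1+len : n ≡ suc (len P)
    n≡1+len = ≤-antisym
      (injective⇒≤ {f = λ x → fromℕ< (s≤s (position≤len x))}
        λ {x} {y} e → position-injective (Finₚ.fromℕ<-injective _ _ (s≤s (position≤len x)) (s≤s (position≤len y)) e))
      (1+len≤n P)

    module _ (chordless : Chordless P) where

      adjacent⇒consecutive : ∀ {x y} → Adjacent x y → Consecutive (position x) (position y)
      adjacent⇒consecutive x~y =
        chordless (position≤len _) (position≤len _) (subst₂ Adjacent (sym (vertex-position _)) (sym (vertex-position _)) x~y)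

      -- Along the path, a walk can only move to a neighbouring position.
      module _ {k} (χ : TotalColoring G k) (c : Fin k) where

        monoWalk-inner : ∀ {a b x} → MonoWalk G χ c a b → position a < position x → position x < position b → vcol χ x ≡ c
        monoWalk-inner (edge a~b _) a<x x<b = ⊥-elim (consecutive-no-gap (adjacent⇒consecutive a~b) a<x x<b)
        monoWalk-inner {x = x} (cons {w = w} a~w _ w-c rest) a<x x<b with <-cmp (position w) (position x)
        ... | tri< w<x _ _ = monoWalk-inner rest w<x x<b
        ... | tri≈ _ w≡x _ = subst (λ z → vcol χ z ≡ c) (position-injective w≡x) w-c
        ... | tri> _ _ x<w = ⊥-elim (consecutive-no-gap (adjacent⇒consecutive a~w) a<x x<w)

        edge-crossing : ∀ {a b x y} → Adjacent a b → ecol χ a b ≡ c → suc (position x) ≡ position y →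
                        position a ≤ position x → position x < position b → ecol χ x y ≡ c
        edge-crossing a~b e x→y a≤x x<b =
          let (a≡x , b≡1+x) = consecutive-crossing (adjacent⇒consecutive a~b) a≤x x<b
          in subst₂ (λ p q → ecol χ p q ≡ c) (position-injective a≡x) (position-injective (trans b≡1+x x→y)) e

        monoWalk-edge : ∀ {a b x y} → MonoWalk G χ c a b → suc (position x) ≡ position y →
                        position a ≤ position x → position x < position b → ecol χ x y ≡ c
        monoWalk-edge (edge a~b e) = edge-crossing a~b e
        monoWalk-edge {x = x} (cons {w = w} a~w e _ rest) x→y a≤x x<b with position x <? position w
        ... | yes x<w = edge-crossing a~w e x→y a≤x x<w
        ... | no  x≮w = monoWalk-edge rest x→y (≮⇒≥ x≮w) x<b

      chordless⇒tmc≤3 : 0 < len P → ∀ k → HasTMC G k → k ≤ 3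
      chordless⇒tmc≤3 0<len k (χ , uses , tmc) = cover⇒≤ color covered
        where
          ends-path : TotalMonoPath G χ (first P) (last P)
          ends-path = tmc (first P) (last P) (first≢last P 0<len)

          c : Fin k
          c = proj₁ ends-path

          color : Fin 3 → Fin k
          color zero             = c
          color (suc zero)       = vcol χ (first P)
          color (suc (suc zero)) = vcol χ (last P)

          position-first : position (first P) ≡ 0
          position-first = position-vertex z≤n

          position-last : position (last P) ≡ len P
          position-last = position-vertex ≤-refl

          vertex-color : ∀ x → ∃ λ t → color t ≡ vcol χ x
          vertex-color x with position x ≟ 0 | position x ≟ len P
          ... | yes x≡0  | _          = suc zero , cong (vcol χ) (position-injective (trans position-first (sym x≡0)))
          ... | _        | yes x≡len = suc (suc zero) , cong (vcol χ) (position-injective (trans position-last (sym x≡len)))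
          ... | no x≢0   | no x≢len   = zero , sym (monoWalk-inner χ c (proj₁ (proj₂ ends-path))
                                      (subst (_< position x) (sym position-first) (n≢0⇒n>0 x≢0))
                                      (subst (position x <_) (sym position-last) (≤∧≢⇒< (position≤len x) x≢len)))

          forward-edge-color : ∀ {x y} → suc (position x) ≡ position y → ecol χ x y ≡ c
          forward-edge-color {x} {y} x→y = monoWalk-edge χ c (proj₁ (proj₂ ends-path)) x→y
            (subst (_≤ position x) (sym position-first) z≤n)
            (subst (position x <_) (sym position-last) (subst (_≤ len P) (sym x→y) (position≤len y)))

          edge-color : ∀ {x y} → Adjacent x y → ecol χ x y ≡ c
          edge-color {x} {y} x~y with adjacent⇒consecutive x~y
          ... | inj₁ x→y = forward-edge-color x→y
          ... | inj₂ y→x = trans (ecolSym χ x y) (forward-edge-color y→x)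

          covered : ∀ d → ∃ λ t → color t ≡ d
          covered d with uses d
          ... | inj₁ (x , x-d)            = let (t , e) = vertex-color x in t , trans e x-d
          ... | inj₂ (x , y , x~y , xy-d) = zero , trans (sym (edge-color x~y)) xy-d

      chordless⇒IsPath : IsPath G
      chordless⇒IsPath = mk↔ₛ′ to from to∘from from∘to , λ i j →
        mk⇔ (chordless (index≤len i) (index≤len j)) (consecutive⇒adjacent P (index≤len i) (index≤len j))
        where
          index≤len : (i : Fin n) → toℕ i ≤ len P
          index≤len i = ≤-pred (subst (toℕ i <_) n≡1+len (toℕ<n i))

          to from : Fin n → Fin n
          to i   = vertex P (toℕ i)
          from x = fromℕ< (subst (position x <_) (sym n≡1+len) (s≤s (position≤len x)))

          to∘from : ∀ x → to (from x) ≡ x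
          to∘from x = trans (cong (vertex P) (toℕ-fromℕ< _)) (vertex-position x)

          from∘to : ∀ i → from (to i) ≡ i
          from∘to i = toℕ-injective (trans (toℕ-fromℕ< _) (position-vertex (index≤len i)))

  crossing : ∀ {S : Subset n} {u z} → Reach G u z → u ∈ₛ S → z ∉ₛ S → ∃₂ λ x y → x ∈ₛ S × y ∉ₛ S × Adjacent x y
  crossing here u∈S z∉S = ⊥-elim (z∉S u∈S)
  crossing {S} (step {w = w} u~w w⇝z) u∈S z∉S with w ∈ₛ? S
  ... | yes w∈S = crossing w⇝z w∈S z∉S
  ... | no  w∉S = _ , w , u∈S , w∉S , u~w

  module _ (conn : Connected G) (P : SimplePath)
           (first-saturated : Saturated P (first P)) (last-saturated : Saturated P (last P)) where

    private
      Inner : Subset n → Fin n → Set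
      Inner S x = x ∈ₛ S × x ≢ first P × x ≢ last P

      InternallyConnected : Subset n → (Fin n → Set) → Set
      InternallyConnected S Q = ∀ {a b} → a ∈ₛ S → b ∈ₛ S → Σ (Star Adjacent a b) (AllInner Q)

      Invariant : Subset n → Set
      Invariant S = (∀ {x} → OnPath P x → x ∈ₛ S) × InternallyConnected S (Inner S)

      pathSet : Subset n
      pathSet = tabulate λ x → does (onPath? P x)

      onPath⇒∈pathSet : ∀ {x} → OnPath P x → x ∈ₛ pathSet
      onPath⇒∈pathSet {x} x∈P = lookup⇒[]= x pathSet (trans (lookup∘tabulate _ x) (dec-true (onPath? P x) x∈P))

      ∈pathSet⇒onPath : ∀ {x} → x ∈ₛ pathSet → OnPath P x
      ∈pathSet⇒onPath {x} x∈ = witness (onPath? P x) (trans (sym (lookup∘tabulate _ x)) ([]=⇒lookup x∈))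
        where
          witness : ∀ {A : Set} (d : Dec A) → does d ≡ true → A
          witness (yes a) _ = a

      pathSet-invariant : Invariant pathSet
      pathSet-invariant = onPath⇒∈pathSet , connected
        where
          connected : InternallyConnected pathSet (Inner pathSet)
          connected a∈ b∈ with ∈pathSet⇒onPath a∈ | ∈pathSet⇒onPath b∈
          ... | i , i≤len , refl | j , j≤len , refl =
            let (p , p-inner) = walkAlong P i≤len j≤len
            in p , λ x∈ → Sum.map₂ (Sum.map₂ λ { (k , 0<k , k<len , refl) →
                     onPath⇒∈pathSet (k , <⇒≤ k<len , refl) , inner≢first P 0<k (<⇒≤ k<len) , inner≢last P k<len })
                     (p-inner x∈)

      extend : ∀ {S x y} → Invariant S → x ∈ₛ S → y ∉ₛ S → Adjacent x y → InternallyConnected (S ∪ ⁅ y ⁆) (Inner S)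
      extend {S} {x} {y} (path⊆S , connected) x∈S y∉S x~y a∈ b∈ = join (x∈p∪q⁻ S ⁅ y ⁆ a∈) (x∈p∪q⁻ S ⁅ y ⁆ b∈)
        where
          y∉P : ¬ OnPath P y
          y∉P = y∉S ∘ path⊆S

          x-inner : ∀ {z} → z ≡ x → Inner S z
          x-inner refl = x∈S , (λ { refl → y∉P (first-saturated x~y) }) , (λ { refl → y∉P (last-saturated x~y) })

          join : ∀ {a b} → a ∈ₛ S ⊎ a ∈ₛ ⁅ y ⁆ → b ∈ₛ S ⊎ b ∈ₛ ⁅ y ⁆ → Σ (Star Adjacent a b) (AllInner (Inner S))
          join (inj₁ a∈S) (inj₁ b∈S) = connected a∈S b∈S
          join (inj₂ a∈y) (inj₂ b∈y) with x∈⁅y⁆⇒x≡y y a∈y | x∈⁅y⁆⇒x≡y y b∈y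
          ... | refl | refl = ε , λ { (here e) → inj₁ e }
          join (inj₂ a∈y) (inj₁ b∈S) with x∈⁅y⁆⇒x≡y y a∈y
          ... | refl = let (p , p-inner) = connected x∈S b∈S
                       in trans (Adj-sym G _ _) x~y ◅ p ,
                          λ { (here e) → inj₁ e ; (there z∈) → Sum.[ inj₂ ∘ inj₂ ∘ x-inner , inj₂ ] (p-inner z∈) }
          join (inj₁ a∈S) (inj₂ b∈y) with x∈⁅y⁆⇒x≡y y b∈y
          ... | refl = let (p , p-inner) = connected a∈S x∈S
                       in p ◅◅ (x~y ◅ ε) ,
                          λ z∈ → Sum.[ Sum.map₂ Sum.[ inj₂ ∘ x-inner , inj₂ ] ∘ p-inner
                                     , (λ { (here e) → inj₂ (inj₂ (x-inner e)) ; (there (here e)) → inj₂ (inj₁ e) }) ]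
                                     (∈-vertices-◅◅ p _ z∈)

      extend-invariant : ∀ {S x y} → Invariant S → x ∈ₛ S → y ∉ₛ S → Adjacent x y → Invariant (S ∪ ⁅ y ⁆)
      extend-invariant {y = y} inv x∈S y∉S x~y =
        (λ x∈P → p⊆p∪q ⁅ y ⁆ (proj₁ inv x∈P)) ,
        λ a∈ b∈ → let (p , p-inner) = extend inv x∈S y∉S x~y a∈ b∈
                  in p , λ z∈ → Sum.map₂ (Sum.map₂ λ (z∈S , z≢first , z≢last) → p⊆p∪q ⁅ y ⁆ z∈S , z≢first , z≢last) (p-inner z∈)

      full⇒HasTMC4 : ∀ {S y} → Invariant S → y ∉ₛ S → (∀ z → z ∈ₛ S ∪ ⁅ y ⁆) →
                     InternallyConnected (S ∪ ⁅ y ⁆) (Inner S) → HasTMC G 4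
      full⇒HasTMC4 {S} {y} (path⊆S , _) y∉S full connected =
        leaves⇒HasTMC leaves unique
          (λ {u} {v} _ → let (p , p-inner) = connected (full u) (full v)
                          in p , λ z∈ → Sum.map₂ (Sum.map₂ inner∉leaves) (p-inner z∈))
          (first≢last P 0<len)
        where
          leaves : List (Fin n)
          leaves = first P ∷ last P ∷ y ∷ []

          0<len : 0 < len P
          0<len = positiveLength conn P first-saturated λ y≡first → y∉S (path⊆S (0 , z≤n , sym y≡first))

          ≢y : ∀ {z} → z ∈ₛ S → z ≢ y
          ≢y z∈S refl = y∉S z∈S

          unique : Unique leaves
          unique = (first≢last P 0<len All.∷ ≢y (path⊆S (0 , z≤n , refl)) All.∷ All.[])
                 ∷ (≢y (path⊆S (len P , ≤-refl , refl)) All.∷ All.[]) ∷ All.[] ∷ []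

          inner∉leaves : ∀ {z} → Inner S z → z ∉ leaves
          inner∉leaves (z∈S , z≢first , z≢last) = All¬⇒¬Any (z≢first All.∷ z≢last All.∷ ≢y z∈S All.∷ All.[])

      grow : ∀ fuel {S} → Invariant S → n ≤ ∣ S ∣ + fuel → ∀ {z} → z ∉ₛ S → HasTMC G 4
      grow zero _ bound z∉S = ⊥-elim (<⇒≱ (∉⇒∣p∣<n z∉S) (subst (n ≤_) (+-identityʳ _) bound))
      grow (suc fuel) {S} inv bound z∉S with crossing (conn (first P) _) (proj₁ inv (0 , z≤n , refl)) z∉S
      ... | x , y , x∈S , y∉S , x~y with Finₚ.all? (_∈ₛ? (S ∪ ⁅ y ⁆))
      ...   | yes full = full⇒HasTMC4 inv y∉S full (extend inv x∈S y∉S x~y)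
      ...   | no ¬full =
        grow fuel (extend-invariant inv x∈S y∉S x~y)
          (≤-trans bound (subst (_≤ ∣ S ∪ ⁅ y ⁆ ∣ + fuel) (sym (+-suc ∣ S ∣ fuel)) (+-monoˡ-≤ fuel ∣S∣<∣S∪y∣)))
          (proj₂ (Finₚ.¬∀⟶∃¬ n _ (_∈ₛ? (S ∪ ⁅ y ⁆)) ¬full))
        where
          ∣S∣<∣S∪y∣ : ∣ S ∣ < ∣ S ∪ ⁅ y ⁆ ∣
          ∣S∣<∣S∪y∣ = p⊂q⇒∣p∣<∣q∣ (p⊆p∪q ⁅ y ⁆ , y , x∈p∪q⁺ (inj₂ (x∈⁅x⁆ y)) , y∉S)

    offPath⇒HasTMC4 : ∀ {z} → ¬ OnPath P z → HasTMC G 4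
    offPath⇒HasTMC4 z∉P = grow n pathSet-invariant (m≤n+m n _) (z∉P ∘ ∈pathSet⇒onPath)

module _ {m : ℕ} (G : Graph (suc m)) where

  open SimplePath

  isPath⇒chordlessHamiltonian : IsPath G → Σ (SimplePath G) λ P → len P ≡ m × Hamiltonian G P × Chordless G P
  isPath⇒chordlessHamiltonian (f , adj⇔) = P , refl , hamiltonian , chordless
    where
      open Inverse f using (to; from; strictlyInverseˡ; strictlyInverseʳ)

      -- The index i is only meaningful for i ≤ m; beyond that it wraps around.
      index : ℕ → Fin (suc m)
      index i = i mod suc m

      toℕ-index : ∀ {i} → i ≤ m → toℕ (index i) ≡ i
      toℕ-index i≤m = trans (toℕ-fromℕ< _) (m<n⇒m%n≡m (s≤s i≤m))

      to-injective : ∀ {a b} → to a ≡ to b → a ≡ b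
      to-injective {a} {b} e = trans (sym (strictlyInverseʳ a)) (trans (cong from e) (strictlyInverseʳ b))

      P : SimplePath G
      P = record
        { len              = m
        ; vertex           = to ∘ index
        ; vertex-injective = λ i≤m j≤m e → trans (sym (toℕ-index i≤m)) (trans (cong toℕ (to-injective e)) (toℕ-index j≤m))
        ; vertex-adjacent  = λ i<m → Equivalence.from (adj⇔ _ _)
                               (inj₁ (trans (cong suc (toℕ-index (<⇒≤ i<m))) (sym (toℕ-index i<m))))
        }

      hamiltonian : Hamiltonian G P
      hamiltonian x = toℕ (from x) , ≤-pred (toℕ<n (from x)) ,
                      trans (cong to (toℕ-injective (toℕ-index (≤-pred (toℕ<n (from x)))))) (strictlyInverseˡ x)

      chordless : Chordless G P
      chordless i≤m j≤m adj = subst₂ Consecutive (toℕ-index i≤m) (toℕ-index j≤m) (Equivalence.to (adj⇔ _ _) adj)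

theorem3 : (n : ℕ) → 2 ≤ n → (G : Graph n) → Connected G →
    TmcIs G 3 ⇔ IsPath G
theorem3 (suc (suc m)) (s≤s (s≤s z≤n)) G conn = mk⇔ tmc≡3⇒isPath isPath⇒tmc≡3
  where
    isPath⇒tmc≡3 : IsPath G → TmcIs G 3
    isPath⇒tmc≡3 isPath =
      let (P , len≡ , hamiltonian , chordless) = isPath⇒chordlessHamiltonian G isPath
          0<len = subst (0 <_) (sym len≡) (s≤s z≤n)
      in hamiltonian⇒HasTMC3 G P hamiltonian 0<len , chordless⇒tmc≤3 G P hamiltonian chordless 0<len

    tmc≡3⇒isPath : TmcIs G 3 → IsPath G
    tmc≡3⇒isPath (_ , maximal) =
      let (P , first-saturated , last-saturated) = maximalPath G zero
          (v , v≢first) = another (SimplePath.first P)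
          0<len = positiveLength G conn P first-saturated v≢first
          hamiltonian : Hamiltonian G P
          hamiltonian x = decidable-stable (SimplePath.onPath? P x)
                            (no4 ∘ offPath⇒HasTMC4 G conn P first-saturated last-saturated)
          chordless : Chordless G P
          chordless {i} {j} i≤len j≤len i~j = decidable-stable (consecutive? i j) λ i≁j →
                                                no4 (chord⇒HasTMC4 G P hamiltonian 0<len (i , j , i≤len , j≤len , i~j , i≁j))
      in chordless⇒IsPath G P hamiltonian chordless
      where
        no4 : ¬ HasTMC G 4
        no4 = n≮n 3 ∘ maximal 4

        another : ∀ (v : Fin (suc (suc m))) → ∃ λ x → x ≢ v
        another zero    = suc zero , λ ()
        another (suc _) = zero , λ ()
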